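{- Let $s\ge 1$ and $n$ be integers with $s\le n<2s$, and let $m,k\ge 0$. Then $$T_{n\times m}(s,k)=(n-s+1)^k\,T_{s\times m}(s,k).$$
   Context: For positive integers $s,n$ and a nonnegative integer $m$, $T_{n\times m}(s,k)$ denotes the number of tilings of an $n\times m$ rectangle (width $n$, length $m$, on the unit grid) by exactly $k$ non-overlapping $s\times s$ squares with sides on grid lines together with $nm-ks^2$ unit ($1\times 1$) squares covering the rest. Tilings related by rotation or reflection are counted as distinct. -}

module Defs where

open import Data.Nat using (ℕ; zero; suc; _+_; _*_; _^_; _≤ᵇ_)
open import Data.Bool using (Bool; true; false; _∧_; _∨_)
open import Data.List using (List; []; _∷_; map; length; filter; concatMap; upTo)
open import Data.Product using (_×_; _,_)
open import Relation.Nullary.Decidable using (Dec)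
open import Data.Bool.Properties using (T?)

-- A cell / position of the unit grid: (row , column), row < n, column < m.
Pos : Set
Pos = ℕ × ℕ

cells : ℕ → ℕ → List Pos
cells n m = concatMap (λ i → map (λ j → (i , j)) (upTo m)) (upTo n)

fits : ℕ → ℕ → ℕ → Pos → Bool
fits n m s (i , j) = (i + s ≤ᵇ n) ∧ (j + s ≤ᵇ m)

disjoint : ℕ → Pos → Pos → Bool
disjoint s (a , b) (c , d) = (a + s ≤ᵇ c) ∨ (c + s ≤ᵇ a) ∨ (b + s ≤ᵇ d) ∨ (d + s ≤ᵇ b)

allᵇ : {A : Set} → (A → Bool) → List A → Bool
allᵇ p []       = true
allᵇ p (x ∷ xs) = p x ∧ allᵇ p xs

-- all k-element sublists (= k-subsets, for a duplicate-free list)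
choose : {A : Set} → ℕ → List A → List (List A)
choose zero    xs       = [] ∷ []
choose (suc k) []       = []
choose (suc k) (x ∷ xs) = map (x ∷_) (choose k xs) Data.List.++ choose (suc k) xs

pairwiseDisjoint : ℕ → List Pos → Bool
pairwiseDisjoint s []       = true
pairwiseDisjoint s (p ∷ ps) = allᵇ (disjoint s p) ps ∧ pairwiseDisjoint s ps

valid : ℕ → ℕ → ℕ → List Pos → Bool
valid n m s ps = allᵇ (fits n m s) ps ∧ pairwiseDisjoint s ps

-- T_{n×m}(s,k): a tiling by k s×s squares and unit squares is determined by
-- the set of positions of its k s×s squares (the unit squares fill the rest
-- uniquely), so we count k-subsets of placements that are valid.
Tnm : ℕ → ℕ → ℕ → ℕ → ℕ
Tnm n m s k = length (filter (λ ps → T? (valid n m s ps)) (choose k (cells n m)))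

-- Since n < 2s, every square starts in a row i < s, so any two squares share a row and they
-- overlap exactly when their column intervals meet.  Non-overlap is therefore a condition on
-- columns alone, and in particular no two squares share a column.  A tiling is thus a choice
-- of columns for the k squares, exactly as in an s × m strip, together with an independent
-- choice of one of the n - s + 1 row offsets for each square.
-- To count, the placements are listed column by column (the number of admissible k-sublists
-- does not depend on the listing); the squares of the first column pairwise overlap, so a
-- configuration uses at most one of them, and induction finishes.
module Submission where

open import Defs
open import Data.Nat using (ℕ; zero; suc; _≤_; _<_; _+_; _*_; _∸_; _^_; _≤ᵇ_; s≤s)
open import Data.Nat.Properties
open import Data.Bool using (Bool; true; false; _∧_; _∨_; if_then_else_; T)
open import Data.Bool.Properties using (T?; ∨-comm; ∨-commutativeMonoid; ∧-commutativeMonoid)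
open import Data.List using (List; []; _∷_; _++_; map; length; filterᵇ; concatMap; upTo; applyUpTo)
open import Data.List.Properties using (length-++; length-upTo; ++-identityʳ; filter-++; filter-all; filter-none)
open import Data.List.Relation.Unary.All as All using (All; []; _∷_)
open import Data.List.Relation.Unary.All.Properties using (applyUpTo⁺₁; applyUpTo⁺₂; all-filter)
open import Data.List.Relation.Binary.Permutation.Propositional as ↭ using (_↭_)
open import Data.List.Relation.Binary.Permutation.Propositional.Properties using (++⁺ˡ; shifts)
open import Data.Product using (_×_; _,_)
open import Function using (_∘_; id)
open import Relation.Binary.PropositionalEquality using (_≡_; refl; sym; trans; cong; cong₂; _≗_; module ≡-Reasoning)
open import Relation.Nullary using (¬_)
open import Relation.Nullary.Decidable using (dec-false)
open import Algebra.Bundles using (CommutativeMonoid)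
import Algebra.Properties.CommutativeSemigroup as CommSemigroupProperties

open ≡-Reasoning

private
  variable
    A B : Set

  module ℕ+ = CommSemigroupProperties +-commutativeSemigroup
  module 𝔹∧ = CommSemigroupProperties (CommutativeMonoid.commutativeSemigroup ∧-commutativeMonoid)
  module 𝔹∨ = CommSemigroupProperties (CommutativeMonoid.commutativeSemigroup ∨-commutativeMonoid)

countᵇ : (A → Bool) → List A → ℕ
countᵇ p xs = length (filterᵇ p xs)

countᵇ-++ : (p : A → Bool) (xs ys : List A) → countᵇ p (xs ++ ys) ≡ countᵇ p xs + countᵇ p ys
countᵇ-++ p xs ys = trans (cong length (filter-++ (T? ∘ p) xs ys)) (length-++ (filterᵇ p xs))

countᵇ-map : (p : B → Bool) (f : A → B) (xs : List A) → countᵇ p (map f xs) ≡ countᵇ (p ∘ f) xs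
countᵇ-map p f [] = refl
countᵇ-map p f (x ∷ xs) with p (f x)
... | true  = cong suc (countᵇ-map p f xs)
... | false = countᵇ-map p f xs

countᵇ-cong : {p q : A → Bool} → p ≗ q → countᵇ p ≗ countᵇ q
countᵇ-cong p≗q [] = refl
countᵇ-cong {q = q} p≗q (x ∷ xs) rewrite p≗q x with q x
... | true  = cong suc (countᵇ-cong p≗q xs)
... | false = countᵇ-cong p≗q xs

countᵇ-none : (p : A → Bool) → (∀ x → p x ≡ false) → ∀ xs → countᵇ p xs ≡ 0
countᵇ-none p none [] = refl
countᵇ-none p none (x ∷ xs) rewrite none x = countᵇ-none p none xs

countᵇ-choose-∷ : (q : List A → Bool) (k : ℕ) (x : A) (xs : List A) →
  countᵇ q (choose (suc k) (x ∷ xs)) ≡ countᵇ (q ∘ (x ∷_)) (choose k xs) + countᵇ q (choose (suc k) xs)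
countᵇ-choose-∷ q k x xs =
  trans (countᵇ-++ q (map (x ∷_) (choose k xs)) (choose (suc k) xs))
        (cong (_+ countᵇ q (choose (suc k) xs)) (countᵇ-map q (x ∷_) (choose k xs)))

countᵇ-choose-filterᵇ : (f : A → Bool) (q : List A → Bool) (k : ℕ) (xs : List A) →
  countᵇ (λ ps → allᵇ f ps ∧ q ps) (choose k xs) ≡ countᵇ q (choose k (filterᵇ f xs))
countᵇ-choose-filterᵇ f q zero xs with q []
... | true  = refl
... | false = refl
countᵇ-choose-filterᵇ f q (suc k) [] = refl
countᵇ-choose-filterᵇ {A = A} f q (suc k) (x ∷ xs) with f x in fx
... | true = begin
  countᵇ all∧q (choose (suc k) (x ∷ xs))
    ≡⟨ countᵇ-choose-∷ all∧q k x xs ⟩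
  countᵇ (all∧q ∘ (x ∷_)) (choose k xs) + countᵇ all∧q (choose (suc k) xs)
    ≡⟨ cong₂ _+_ (trans (countᵇ-cong (λ ps → cong (λ b → (b ∧ allᵇ f ps) ∧ q (x ∷ ps)) fx) (choose k xs))
                        (countᵇ-choose-filterᵇ f (q ∘ (x ∷_)) k xs))
                 (countᵇ-choose-filterᵇ f q (suc k) xs) ⟩
  countᵇ (q ∘ (x ∷_)) (choose k (filterᵇ f xs)) + countᵇ q (choose (suc k) (filterᵇ f xs))
    ≡⟨ countᵇ-choose-∷ q k x (filterᵇ f xs) ⟨
  countᵇ q (choose (suc k) (x ∷ filterᵇ f xs)) ∎
  where
  all∧q : List A → Bool
  all∧q ps = allᵇ f ps ∧ q ps
... | false = begin
  countᵇ all∧q (choose (suc k) (x ∷ xs))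
    ≡⟨ countᵇ-choose-∷ all∧q k x xs ⟩
  countᵇ (all∧q ∘ (x ∷_)) (choose k xs) + countᵇ all∧q (choose (suc k) xs)
    ≡⟨ cong₂ _+_ (countᵇ-none _ (λ ps → cong (λ b → (b ∧ allᵇ f ps) ∧ q (x ∷ ps)) fx) (choose k xs))
                 (countᵇ-choose-filterᵇ f q (suc k) xs) ⟩
  countᵇ q (choose (suc k) (filterᵇ f xs)) ∎
  where
  all∧q : List A → Bool
  all∧q ps = allᵇ f ps ∧ q ps

pairwiseᵇ : (A → A → Bool) → List A → Bool
pairwiseᵇ d []       = true
pairwiseᵇ d (x ∷ xs) = allᵇ (d x) xs ∧ pairwiseᵇ d xs

countPairwise : (A → A → Bool) → ℕ → List A → ℕ
countPairwise d k xs = countᵇ (pairwiseᵇ d) (choose k xs)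

countPairwise-∷ : (d : A → A → Bool) (k : ℕ) (x : A) (xs : List A) →
  countPairwise d (suc k) (x ∷ xs) ≡ countPairwise d k (filterᵇ (d x) xs) + countPairwise d (suc k) xs
countPairwise-∷ d k x xs =
  trans (countᵇ-choose-∷ (pairwiseᵇ d) k x xs)
        (cong (_+ countPairwise d (suc k) xs) (countᵇ-choose-filterᵇ (d x) (pairwiseᵇ d) k xs))

↭-Invariant : (List A → Bool) → Set
↭-Invariant {A} q = ∀ {xs ys : List A} → xs ↭ ys → q xs ≡ q ys

allᵇ-↭ : (f : A → Bool) → ↭-Invariant (allᵇ f)
allᵇ-↭ f ↭.refl = refl
allᵇ-↭ f (↭.prep x p) = cong (f x ∧_) (allᵇ-↭ f p)
allᵇ-↭ f (↭.swap x y p) = trans (𝔹∧.x∙yz≈y∙xz (f x) (f y) _) (cong (λ b → f y ∧ f x ∧ b) (allᵇ-↭ f p))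
allᵇ-↭ f (↭.trans p q) = trans (allᵇ-↭ f p) (allᵇ-↭ f q)

pairwiseᵇ-↭ : (d : A → A → Bool) → (∀ x y → d x y ≡ d y x) → ↭-Invariant (pairwiseᵇ d)
pairwiseᵇ-↭ d sym-d ↭.refl = refl
pairwiseᵇ-↭ d sym-d (↭.prep x p) = cong₂ _∧_ (allᵇ-↭ (d x) p) (pairwiseᵇ-↭ d sym-d p)
pairwiseᵇ-↭ d sym-d {x ∷ y ∷ xs} (↭.swap x y p) =
  trans (𝔹∧.interchange (d x y) (allᵇ (d x) xs) (allᵇ (d y) xs) (pairwiseᵇ d xs))
        (cong₂ _∧_ (cong₂ _∧_ (sym-d x y) (allᵇ-↭ (d y) p))
                   (cong₂ _∧_ (allᵇ-↭ (d x) p) (pairwiseᵇ-↭ d sym-d p)))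
pairwiseᵇ-↭ d sym-d (↭.trans p q) = trans (pairwiseᵇ-↭ d sym-d p) (pairwiseᵇ-↭ d sym-d q)

ChooseCountsAgree : List A → List A → Set
ChooseCountsAgree {A} xs ys =
  (q : List A → Bool) → ↭-Invariant q → ∀ k → countᵇ q (choose k xs) ≡ countᵇ q (choose k ys)

chooseCountsAgree-∷ : (x : A) {xs ys : List A} → ChooseCountsAgree xs ys → ChooseCountsAgree (x ∷ xs) (x ∷ ys)
chooseCountsAgree-∷ x agree q q-inv zero = refl
chooseCountsAgree-∷ x {xs} {ys} agree q q-inv (suc k) = begin
  countᵇ q (choose (suc k) (x ∷ xs))
    ≡⟨ countᵇ-choose-∷ q k x xs ⟩
  countᵇ (q ∘ (x ∷_)) (choose k xs) + countᵇ q (choose (suc k) xs)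
    ≡⟨ cong₂ _+_ (agree (q ∘ (x ∷_)) (λ p → q-inv (↭.prep x p)) k) (agree q q-inv (suc k)) ⟩
  countᵇ (q ∘ (x ∷_)) (choose k ys) + countᵇ q (choose (suc k) ys)
    ≡⟨ countᵇ-choose-∷ q k x ys ⟨
  countᵇ q (choose (suc k) (x ∷ ys)) ∎

chooseCountsAgree-swap : (x y : A) (xs : List A) → ChooseCountsAgree (x ∷ y ∷ xs) (y ∷ x ∷ xs)
chooseCountsAgree-swap x y xs q q-inv zero = refl
chooseCountsAgree-swap {A = A} x y xs q q-inv (suc k) = begin
  countᵇ q (choose (suc k) (x ∷ y ∷ xs))
    ≡⟨ countᵇ-choose-∷ q k x (y ∷ xs) ⟩
  with-head x y + countᵇ q (choose (suc k) (y ∷ xs))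
    ≡⟨ cong (with-head x y +_) (countᵇ-choose-∷ q k y xs) ⟩
  with-head x y + (without y + rest)
    ≡⟨ +-assoc (with-head x y) _ _ ⟨
  (with-head x y + without y) + rest
    ≡⟨ cong (_+ rest) (heads k) ⟩
  (with-head y x + without x) + rest
    ≡⟨ +-assoc (with-head y x) _ _ ⟩
  with-head y x + (without x + rest)
    ≡⟨ cong (with-head y x +_) (countᵇ-choose-∷ q k x xs) ⟨
  with-head y x + countᵇ q (choose (suc k) (x ∷ xs))
    ≡⟨ countᵇ-choose-∷ q k y (x ∷ xs) ⟨
  countᵇ q (choose (suc k) (y ∷ x ∷ xs)) ∎
  where
  with-head : A → A → ℕ
  with-head u v = countᵇ (q ∘ (u ∷_)) (choose k (v ∷ xs))
  without : A → ℕ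
  without u = countᵇ (q ∘ (u ∷_)) (choose k xs)
  rest : ℕ
  rest = countᵇ q (choose (suc k) xs)
  heads : ∀ k → countᵇ (q ∘ (x ∷_)) (choose k (y ∷ xs)) + countᵇ (q ∘ (y ∷_)) (choose k xs)
              ≡ countᵇ (q ∘ (y ∷_)) (choose k (x ∷ xs)) + countᵇ (q ∘ (x ∷_)) (choose k xs)
  heads zero = +-comm (countᵇ (q ∘ (x ∷_)) (choose 0 xs)) (countᵇ (q ∘ (y ∷_)) (choose 0 xs))
  heads (suc j) = begin
    countᵇ (q ∘ (x ∷_)) (choose (suc j) (y ∷ xs)) + countᵇ (q ∘ (y ∷_)) (choose (suc j) xs)
      ≡⟨ cong (_+ _) (countᵇ-choose-∷ (q ∘ (x ∷_)) j y xs) ⟩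
    (countᵇ (q ∘ (x ∷_) ∘ (y ∷_)) (choose j xs) + countᵇ (q ∘ (x ∷_)) (choose (suc j) xs))
      + countᵇ (q ∘ (y ∷_)) (choose (suc j) xs)
      ≡⟨ ℕ+.xy∙z≈xz∙y (countᵇ (q ∘ (x ∷_) ∘ (y ∷_)) (choose j xs)) _ _ ⟩
    (countᵇ (q ∘ (x ∷_) ∘ (y ∷_)) (choose j xs) + countᵇ (q ∘ (y ∷_)) (choose (suc j) xs))
      + countᵇ (q ∘ (x ∷_)) (choose (suc j) xs)
      ≡⟨ cong (λ c → (c + _) + _) (countᵇ-cong (λ ps → q-inv (↭.swap x y ↭.refl)) (choose j xs)) ⟩
    (countᵇ (q ∘ (y ∷_) ∘ (x ∷_)) (choose j xs) + countᵇ (q ∘ (y ∷_)) (choose (suc j) xs))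
      + countᵇ (q ∘ (x ∷_)) (choose (suc j) xs)
      ≡⟨ cong (_+ _) (countᵇ-choose-∷ (q ∘ (y ∷_)) j x xs) ⟨
    countᵇ (q ∘ (y ∷_)) (choose (suc j) (x ∷ xs)) + countᵇ (q ∘ (x ∷_)) (choose (suc j) xs) ∎

countᵇ-choose-↭ : {xs ys : List A} → xs ↭ ys → ChooseCountsAgree xs ys
countᵇ-choose-↭ ↭.refl q q-inv k = refl
countᵇ-choose-↭ (↭.prep x p) = chooseCountsAgree-∷ x (countᵇ-choose-↭ p)
countᵇ-choose-↭ (↭.swap x y p) q q-inv k =
  trans (chooseCountsAgree-swap x y _ q q-inv k)
        (chooseCountsAgree-∷ y (chooseCountsAgree-∷ x (countᵇ-choose-↭ p)) q q-inv k)
countᵇ-choose-↭ (↭.trans p p′) q q-inv k =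
  trans (countᵇ-choose-↭ p q q-inv k) (countᵇ-choose-↭ p′ q q-inv k)

rowMajor : List A → List B → List (A × B)
rowMajor R J = concatMap (λ i → map (i ,_) J) R

columnMajor : List A → List B → List (A × B)
columnMajor R J = concatMap (λ j → map (_, j) R) J

interleave-↭ : (f : B → A) (g : B → List A) (J : List B) →
  map f J ++ concatMap g J ↭ concatMap (λ j → f j ∷ g j) J
interleave-↭ f g [] = ↭.refl
interleave-↭ f g (j ∷ J) =
  ↭.prep (f j) (↭.trans (shifts (map f J) (g j)) (++⁺ˡ (g j) (interleave-↭ f g J)))

columnMajor-[] : (J : List B) → columnMajor {A = A} [] J ≡ []
columnMajor-[] []      = refl
columnMajor-[] (j ∷ J) = columnMajor-[] J

rowMajor↭columnMajor : (R : List A) (J : List B) → rowMajor R J ↭ columnMajor R J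
rowMajor↭columnMajor []      J = ↭.↭-reflexive (sym (columnMajor-[] J))
rowMajor↭columnMajor (i ∷ R) J =
  ↭.trans (++⁺ˡ (map (i ,_) J) (rowMajor↭columnMajor R J)) (interleave-↭ (i ,_) (λ j → map (_, j) R) J)

filterᵇ-row : (p : A → Bool) (q : B → Bool) (i : A) (J : List B) →
  filterᵇ (λ (i , j) → p i ∧ q j) (map (i ,_) J) ≡ (if p i then map (i ,_) (filterᵇ q J) else [])
filterᵇ-row p q i [] with p i
... | true  = refl
... | false = refl
filterᵇ-row p q i (j ∷ J) with p i | filterᵇ-row p q i J
... | false | ih = ih
... | true  | ih with q j
...   | true  = cong ((i , j) ∷_) ih
...   | false = ih

filterᵇ-rowMajor : (p : A → Bool) (q : B → Bool) (R : List A) (J : List B) →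
  filterᵇ (λ (i , j) → p i ∧ q j) (rowMajor R J) ≡ rowMajor (filterᵇ p R) (filterᵇ q J)
filterᵇ-rowMajor p q [] J = refl
filterᵇ-rowMajor p q (i ∷ R) J
  rewrite filter-++ (T? ∘ λ (i , j) → p i ∧ q j) (map (i ,_) J) (rowMajor R J)
        | filterᵇ-row p q i J | filterᵇ-rowMajor p q R J
  with p i
... | true  = refl
... | false = refl

module ColumnCounting
  {A B : Set} (d : A × B → A × B → Bool) (e : B → B → Bool) (Row : A → Set)
  (d-on-rows : ∀ {i i′} → Row i → Row i′ → ∀ j j′ → d (i , j) (i′ , j′) ≡ e j j′)
  (e-irreflexive : ∀ j → e j j ≡ false)
  where

  filterᵇ-column : ∀ {i} j j′ (R : List A) → Row i → All Row R →
    filterᵇ (d (i , j)) (map (_, j′) R) ≡ (if e j j′ then map (_, j′) R else [])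
  filterᵇ-column j j′ [] row-i [] with e j j′
  ... | true  = refl
  ... | false = refl
  filterᵇ-column j j′ (i′ ∷ R) row-i (row-i′ ∷ rows)
    rewrite d-on-rows row-i row-i′ j j′
    with e j j′ | filterᵇ-column j j′ R row-i rows
  ... | true  | ih = cong ((i′ , j′) ∷_) ih
  ... | false | ih = ih

  filterᵇ-columnMajor : ∀ {i} j (R : List A) (J : List B) → Row i → All Row R →
    filterᵇ (d (i , j)) (columnMajor R J) ≡ columnMajor R (filterᵇ (e j) J)
  filterᵇ-columnMajor j R [] row-i rows = refl
  filterᵇ-columnMajor {i} j R (j′ ∷ J) row-i rows
    rewrite filter-++ (T? ∘ d (i , j)) (map (_, j′) R) (columnMajor R J)
          | filterᵇ-column j j′ R row-i rows | filterᵇ-columnMajor j R J row-i rows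
    with e j j′
  ... | true  = refl
  ... | false = refl

  -- The points of column C are pairwise incompatible (e is irreflexive) and each leaves the
  -- same compatible remainder, so a compatible (k+1)-set meets C at most once, in |C| ways.
  countPairwise-column-++ : ∀ k j (C R : List A) (J : List B) → All Row C → All Row R →
    countPairwise d (suc k) (map (_, j) C ++ columnMajor R J)
      ≡ countPairwise d (suc k) (columnMajor R J) + length C * countPairwise d k (columnMajor R (filterᵇ (e j) J))
  countPairwise-column-++ k j [] R J [] rows = sym (+-identityʳ _)
  countPairwise-column-++ k j (i ∷ C) R J (row-i ∷ rows-C) rows = begin
    countPairwise d (suc k) ((i , j) ∷ map (_, j) C ++ columnMajor R J)
      ≡⟨ countPairwise-∷ d k (i , j) (map (_, j) C ++ columnMajor R J) ⟩
    countPairwise d k (filterᵇ (d (i , j)) (map (_, j) C ++ columnMajor R J)) + countPairwise d (suc k) (map (_, j) C ++ columnMajor R J)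
      ≡⟨ cong₂ _+_ (cong (countPairwise d k) remainder) (countPairwise-column-++ k j C R J rows-C rows) ⟩
    rest + (countPairwise d (suc k) (columnMajor R J) + length C * rest)
      ≡⟨ ℕ+.x∙yz≈y∙xz rest (countPairwise d (suc k) (columnMajor R J)) (length C * rest) ⟩
    countPairwise d (suc k) (columnMajor R J) + length (i ∷ C) * rest ∎
    where
    rest : ℕ
    rest = countPairwise d k (columnMajor R (filterᵇ (e j) J))
    remainder : filterᵇ (d (i , j)) (map (_, j) C ++ columnMajor R J) ≡ columnMajor R (filterᵇ (e j) J)
    remainder rewrite filter-++ (T? ∘ d (i , j)) (map (_, j) C) (columnMajor R J)
                    | filterᵇ-column j j C row-i rows-C | e-irreflexive j
                    = filterᵇ-columnMajor j R J row-i rows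

  countPairwise-columnMajor : (R : List A) → All Row R → ∀ k (J : List B) →
    countPairwise d k (columnMajor R J) ≡ length R ^ k * countPairwise e k J
  countPairwise-columnMajor R rows zero J = refl
  countPairwise-columnMajor R rows (suc k) [] = sym (*-zeroʳ (length R ^ suc k))
  countPairwise-columnMajor R rows (suc k) (j ∷ J) = begin
    countPairwise d (suc k) (columnMajor R (j ∷ J))
      ≡⟨ countPairwise-column-++ k j R R J rows rows ⟩
    countPairwise d (suc k) (columnMajor R J) + r * countPairwise d k (columnMajor R (filterᵇ (e j) J))
      ≡⟨ cong₂ _+_ (countPairwise-columnMajor R rows (suc k) J)
                   (cong (r *_) (countPairwise-columnMajor R rows k (filterᵇ (e j) J))) ⟩
    r ^ suc k * countPairwise e (suc k) J + r * (r ^ k * countPairwise e k (filterᵇ (e j) J))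
      ≡⟨ cong (r ^ suc k * countPairwise e (suc k) J +_) (*-assoc r (r ^ k) _) ⟨
    r ^ suc k * countPairwise e (suc k) J + r ^ suc k * countPairwise e k (filterᵇ (e j) J)
      ≡⟨ *-distribˡ-+ (r ^ suc k) _ _ ⟨
    r ^ suc k * (countPairwise e (suc k) J + countPairwise e k (filterᵇ (e j) J))
      ≡⟨ cong (r ^ suc k *_) (trans (+-comm (countPairwise e (suc k) J) _) (sym (countPairwise-∷ e k j J))) ⟩
    r ^ suc k * countPairwise e (suc k) (j ∷ J) ∎
    where
    r : ℕ
    r = length R

applyUpTo-+ : (f : ℕ → A) (a b : ℕ) → applyUpTo f (a + b) ≡ applyUpTo f a ++ applyUpTo (f ∘ (a +_)) b
applyUpTo-+ f zero    b = refl
applyUpTo-+ f (suc a) b = cong (f 0 ∷_) (applyUpTo-+ (f ∘ suc) a b)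

offsets : ℕ → ℕ → List ℕ
offsets s n = filterᵇ (λ i → i + s ≤ᵇ n) (upTo n)

offsets-upTo : ∀ {s n} → 1 ≤ s → s ≤ n → offsets s n ≡ upTo (suc (n ∸ s))
offsets-upTo {suc s′} {n} _ s≤n = begin
  filterᵇ fitsIn (upTo n)
    ≡⟨ cong (filterᵇ fitsIn) (trans (cong upTo n≡1+t+s′) (applyUpTo-+ id (suc t) s′)) ⟩
  filterᵇ fitsIn (upTo (suc t) ++ applyUpTo (suc t +_) s′)
    ≡⟨ filter-++ (T? ∘ fitsIn) (upTo (suc t)) _ ⟩
  filterᵇ fitsIn (upTo (suc t)) ++ filterᵇ fitsIn (applyUpTo (suc t +_) s′)
    ≡⟨ cong₂ _++_ (filter-all (T? ∘ fitsIn) low-fit) (filter-none (T? ∘ fitsIn) high-overflow) ⟩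
  upTo (suc t) ++ []
    ≡⟨ ++-identityʳ (upTo (suc t)) ⟩
  upTo (suc t) ∎
  where
  s = suc s′
  t = n ∸ s
  fitsIn : ℕ → Bool
  fitsIn i = i + s ≤ᵇ n
  t+s≡n : t + s ≡ n
  t+s≡n = m∸n+n≡m s≤n
  n≡1+t+s′ : n ≡ suc t + s′
  n≡1+t+s′ = trans (sym t+s≡n) (+-suc t s′)
  low-fit : All (T ∘ fitsIn) (upTo (suc t))
  low-fit = applyUpTo⁺₁ id (suc t) λ i<1+t →
    ≤⇒≤ᵇ (≤-trans (+-monoˡ-≤ s (≤-pred i<1+t)) (≤-reflexive t+s≡n))
  high-overflow : All (λ i → ¬ T (fitsIn i)) (applyUpTo (suc t +_) s′)
  high-overflow = applyUpTo⁺₂ (suc t +_) s′ λ x fits →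
    <⇒≱ (≤-trans (≤-reflexive (cong suc (sym t+s≡n))) (+-monoˡ-≤ s (s≤s (m≤m+n t x)))) (≤ᵇ⇒≤ _ n fits)

length-offsets : ∀ {s n} → 1 ≤ s → s ≤ n → length (offsets s n) ≡ n ∸ s + 1
length-offsets {s} {n} 1≤s s≤n =
  trans (cong length (offsets-upTo 1≤s s≤n)) (trans (length-upTo (suc (n ∸ s))) (+-comm 1 (n ∸ s)))

s+s≡2*s : ∀ s → s + s ≡ 2 * s
s+s≡2*s s = cong (s +_) (sym (+-identityʳ s))

offsets-< : ∀ {s n} → n < 2 * s → All (_< s) (offsets s n)
offsets-< {s} {n} n<2s = All.map below (all-filter (T? ∘ λ i → i + s ≤ᵇ n) (upTo n))
  where
  below : ∀ {i} → T (i + s ≤ᵇ n) → i < s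
  below {i} fits = +-cancelʳ-< s i s
    (≤-<-trans (≤ᵇ⇒≤ (i + s) n fits) (≤-trans n<2s (≤-reflexive (sym (s+s≡2*s s)))))

apart : ℕ → ℕ → ℕ → Bool
apart s b b′ = (b + s ≤ᵇ b′) ∨ (b′ + s ≤ᵇ b)

apart-irreflexive : ∀ {s} → 1 ≤ s → ∀ j → apart s j j ≡ false
apart-irreflexive {s} 1≤s j rewrite dec-false (j + s ≤? j) (<⇒≱ (m<m+n j 1≤s)) = refl

disjoint-on-rows : ∀ {s i i′} → i < s → i′ < s → ∀ j j′ → disjoint s (i , j) (i′ , j′) ≡ apart s j j′
disjoint-on-rows {s} {i} {i′} i<s i′<s j j′
  rewrite dec-false (i + s ≤? i′) (<⇒≱ (≤-trans i′<s (m≤n+m s i)))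
        | dec-false (i′ + s ≤? i) (<⇒≱ (≤-trans i<s (m≤n+m s i′)))
        = refl

disjoint-sym : ∀ s p q → disjoint s p q ≡ disjoint s q p
disjoint-sym s (a , b) (c , d) =
  trans (𝔹∨.x∙yz≈y∙xz (a + s ≤ᵇ c) (c + s ≤ᵇ a) _)
        (cong (λ x → (c + s ≤ᵇ a) ∨ (a + s ≤ᵇ c) ∨ x) (∨-comm (b + s ≤ᵇ d) (d + s ≤ᵇ b)))

pairwiseDisjoint≗pairwiseᵇ : ∀ s → pairwiseDisjoint s ≗ pairwiseᵇ (disjoint s)
pairwiseDisjoint≗pairwiseᵇ s []       = refl
pairwiseDisjoint≗pairwiseᵇ s (p ∷ ps) = cong (allᵇ (disjoint s p) ps ∧_) (pairwiseDisjoint≗pairwiseᵇ s ps)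

Tnm≡countPairwise-apart : ∀ s n m k → 1 ≤ s → s ≤ n → n < 2 * s →
  Tnm n m s k ≡ (n ∸ s + 1) ^ k * countPairwise (apart s) k (offsets s m)
Tnm≡countPairwise-apart s n m k 1≤s s≤n n<2s = begin
  Tnm n m s k
    ≡⟨ countᵇ-cong (λ ps → cong (allᵇ (fits n m s) ps ∧_) (pairwiseDisjoint≗pairwiseᵇ s ps)) (choose k (cells n m)) ⟩
  countᵇ (λ ps → allᵇ (fits n m s) ps ∧ pairwiseᵇ (disjoint s) ps) (choose k (cells n m))
    ≡⟨ countᵇ-choose-filterᵇ (fits n m s) (pairwiseᵇ (disjoint s)) k (cells n m) ⟩
  countPairwise (disjoint s) k (filterᵇ (fits n m s) (cells n m))
    ≡⟨ cong (countPairwise (disjoint s) k) (filterᵇ-rowMajor _ _ (upTo n) (upTo m)) ⟩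
  countPairwise (disjoint s) k (rowMajor (offsets s n) (offsets s m))
    ≡⟨ countᵇ-choose-↭ (rowMajor↭columnMajor (offsets s n) (offsets s m))
         (pairwiseᵇ (disjoint s)) (pairwiseᵇ-↭ (disjoint s) (disjoint-sym s)) k ⟩
  countPairwise (disjoint s) k (columnMajor (offsets s n) (offsets s m))
    ≡⟨ ColumnCounting.countPairwise-columnMajor (disjoint s) (apart s) (_< s) disjoint-on-rows (apart-irreflexive 1≤s)
         (offsets s n) (offsets-< n<2s) k (offsets s m) ⟩
  length (offsets s n) ^ k * countPairwise (apart s) k (offsets s m)
    ≡⟨ cong (λ r → r ^ k * countPairwise (apart s) k (offsets s m)) (length-offsets 1≤s s≤n) ⟩
  (n ∸ s + 1) ^ k * countPairwise (apart s) k (offsets s m) ∎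

mainTheorem4 : (s n m k : ℕ) → 1 ≤ s → s ≤ n → n < 2 * s →
    Tnm n m s k ≡ ((n ∸ s) + 1) ^ k * Tnm s m s k
mainTheorem4 s n m k 1≤s s≤n n<2s = begin
  Tnm n m s k
    ≡⟨ Tnm≡countPairwise-apart s n m k 1≤s s≤n n<2s ⟩
  (n ∸ s + 1) ^ k * strips
    ≡⟨ cong ((n ∸ s + 1) ^ k *_) strip-count ⟨
  (n ∸ s + 1) ^ k * Tnm s m s k ∎
  where
  s<2s : s < 2 * s
  s<2s = ≤-trans (m<m+n s 1≤s) (≤-reflexive (s+s≡2*s s))
  strips : ℕ
  strips = countPairwise (apart s) k (offsets s m)
  strip-count : Tnm s m s k ≡ strips
  strip-count = begin
    Tnm s m s k                           ≡⟨ Tnm≡countPairwise-apart s s m k 1≤s ≤-refl s<2s ⟩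
    (s ∸ s + 1) ^ k * strips              ≡⟨ cong (λ r → (r + 1) ^ k * strips) (n∸n≡0 s) ⟩
    1 ^ k * strips                        ≡⟨ cong (_* strips) (^-zeroˡ k) ⟩
    1 * strips                            ≡⟨ *-identityˡ strips ⟩
    strips ∎
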